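{- As formal power series in $t$ and $z$, $$1+\sum_{m=1}^{\infty}\frac{zt}{(1-zt)^{m}}\prod_{i=1}^{m-1}\bigl(1-(1-t)^{i}\bigr) = 1+\sum_{m=1}^{\infty}\prod_{i=1}^{m}\bigl(1-(1-t)^{i-1}(1-zt)\bigr).$$ -}

module Defs where

open import Data.Nat using (ℕ; zero; suc; _∸_; _≤_)
open import Data.Integer using (ℤ; 0ℤ; 1ℤ; -_) renaming (_+_ to _+ℤ_; _*_ to _*ℤ_)
open import Data.Product using (Σ; ∃; _×_)
open import Relation.Binary.PropositionalEquality using (_≡_)

-- A formal power series in two variables t, z with integer coefficients:
-- (f a b) is the coefficient of t^a z^b.
PS : Set
PS = ℕ → ℕ → ℤ

sumUpTo : ℕ → (ℕ → ℤ) → ℤ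
sumUpTo zero    h = h zero
sumUpTo (suc n) h = sumUpTo n h +ℤ h (suc n)

sumBelow : ℕ → (ℕ → ℤ) → ℤ
sumBelow zero    h = 0ℤ
sumBelow (suc n) h = sumBelow n h +ℤ h n

infix 4 _≈_
_≈_ : PS → PS → Set
f ≈ g = ∀ a b → f a b ≡ g a b

zeroPS : PS
zeroPS a b = 0ℤ

onePS : PS
onePS zero zero = 1ℤ
onePS _    _    = 0ℤ

tPS : PS
tPS (suc zero) zero = 1ℤ
tPS _          _    = 0ℤ

zPS : PS
zPS zero (suc zero) = 1ℤ
zPS _    _          = 0ℤ

infixl 6 _⊕_ _⊖_
infixl 7 _⊛_

_⊕_ : PS → PS → PS
(f ⊕ g) a b = f a b +ℤ g a b

negPS : PS → PS
negPS f a b = - f a b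

_⊖_ : PS → PS → PS
f ⊖ g = f ⊕ negPS g

_⊛_ : PS → PS → PS
(f ⊛ g) a b = sumUpTo a (λ i → sumUpTo b (λ j → f i j *ℤ g (a ∸ i) (b ∸ j)))

powPS : PS → ℕ → PS
powPS f zero    = onePS
powPS f (suc n) = powPS f n ⊛ f

prodFrom1 : ℕ → (ℕ → PS) → PS
prodFrom1 zero    h = onePS
prodFrom1 (suc n) h = prodFrom1 n h ⊛ h (suc n)

partialSum1 : ℕ → (ℕ → PS) → PS
partialSum1 zero    F = zeroPS
partialSum1 (suc M) F = partialSum1 M F ⊕ F (suc M)

HasSum1 : (ℕ → PS) → PS → Set
HasSum1 F S = ∀ a b → ∃ λ N → ∀ M → N ≤ M → partialSum1 M F a b ≡ S a b

zt : PS
zt = zPS ⊛ tPS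

-- LHS summand, given an inverse g of (1 - zt):
--   zt/(1-zt)^m ∏_{i=1}^{m-1} (1 - (1-t)^i)
lhsTerm : PS → ℕ → PS
lhsTerm g m = zt ⊛ powPS g m ⊛ prodFrom1 (m ∸ 1) (λ i → onePS ⊖ powPS (onePS ⊖ tPS) i)

rhsTerm : ℕ → PS
rhsTerm m = prodFrom1 m (λ i → onePS ⊖ powPS (onePS ⊖ tPS) (i ∸ 1) ⊛ (onePS ⊖ zt))

module Submission where

-- Both sides of the identity live in ℤ[[z]][[t]], which we build as power
-- series over power series; each series converges t-adically because its m-th
-- term has t-order ≥ m.
--
-- Write q = 1 - t, w = 1 - zt, A n = ∏_{i≤n} (1 - qⁱ), B n = ∏_{i≤n} (1 - qⁱw).
-- Dividing by zt, the left-hand side is S(1/w) with S(X) = Σ_{m≥1} Xᵐ A_{m-1},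
-- and the right-hand side is Σ_{k≥0} B_k.  Since qᵐ A_{m-1} = A_{m-1} - A_m,
-- S(Xq) = 1 + (1 - 1/X) S(X); applied to X_j = 1/(w qʲ) this gives
-- S(X_j) = 1 + (1 - q^{j+1}w) S(X_{j+1}), which unrolls to S(X_0) = Σ_k B_k.

open import Algebra using (CommutativeRing)
open import Data.Nat using (ℕ; zero; suc; _∸_; _≤_; _<_; z≤n; s≤s) renaming (_+_ to _+ℕ_; _*_ to _*ℕ_)
import Data.Nat.Properties as ℕP
import Data.Integer.Properties as ℤP
open import Data.Product using (_,_)
import Relation.Binary.PropositionalEquality as ≡
open import Relation.Nullary using (yes; no)

-- The canonical ring homomorphism ℤ → R.  Its only purpose is to let the
-- standard ring solver, with integer coefficients, normalise polynomial
-- identities in an arbitrary commutative ring.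
module IntegerCoefficients {c ℓ} (R : CommutativeRing c ℓ) where
  open import Data.Integer using (ℤ; +_; -[1+_]; _⊖_; +0; +[1+_]; _≟_)
    renaming (_+_ to _+ℤ_; _*_ to _*ℤ_; -_ to -ℤ_)
  open import Data.Maybe using (Maybe; just; nothing)
  open CommutativeRing R hiding (zero)
  open import Algebra.Properties.Ring ring using (-‿distribˡ-*; -‿distribʳ-*; -‿involutive; -0#≈0#)
  open import Algebra.Properties.AbelianGroup +-abelianGroup using (⁻¹-∙-comm)
  open import Algebra.Properties.Semiring.Mult.TCOptimised semiring using (_×_; 1+×; ×-homo-+; ×1-homo-*)
  open import Algebra.Solver.Ring.AlmostCommutativeRing using (fromCommutativeRing; _-Raw-AlmostCommutative⟶_)
  open import Relation.Binary.Reasoning.Setoid setoid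

  ι : ℤ → Carrier
  ι (+ n)    = n × 1#
  ι -[1+ n ] = - (suc n × 1#)

  ι-cong : ∀ {i j} → i ≡.≡ j → ι i ≈ ι j
  ι-cong ≡.refl = refl

  ι-neg : ∀ i → ι (-ℤ i) ≈ - ι i
  ι-neg -[1+ n ]  = sym (-‿involutive _)
  ι-neg +0        = sym -0#≈0#
  ι-neg +[1+ n ]  = refl

  cancel-+ˡ-difference : ∀ x a b → (x + a) - (x + b) ≈ a - b
  cancel-+ˡ-difference x a b = begin
    (x + a) - (x + b)       ≈⟨ +-congˡ (sym (⁻¹-∙-comm x b)) ⟩
    (x + a) + (- x - b)     ≈⟨ +-congʳ (+-comm x a) ⟩
    (a + x) + (- x - b)     ≈⟨ +-assoc a x _ ⟩
    a + (x + (- x - b))     ≈⟨ +-congˡ (sym (+-assoc x (- x) (- b))) ⟩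
    a + ((x - x) - b)       ≈⟨ +-congˡ (+-congʳ (-‿inverseʳ x)) ⟩
    a + (0# - b)            ≈⟨ +-congˡ (+-identityˡ (- b)) ⟩
    a - b                   ∎

  -- ι is additive; ℤ's addition of mixed signs goes through _⊖_
  ι-⊖ : ∀ m n → ι (m ⊖ n) ≈ m × 1# - n × 1#
  ι-⊖ m       zero    = trans (ι-cong (ℤP.⊖-≥ {m} z≤n)) (sym (trans (+-congˡ -0#≈0#) (+-identityʳ _)))
  ι-⊖ zero    (suc n) = trans (ι-cong (ℤP.⊖-< {0} {suc n} (s≤s z≤n))) (sym (+-identityˡ _))
  ι-⊖ (suc m) (suc n) = begin
    ι (suc m ⊖ suc n)                 ≈⟨ ι-cong (ℤP.[1+m]⊖[1+n]≡m⊖n m n) ⟩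
    ι (m ⊖ n)                         ≈⟨ ι-⊖ m n ⟩
    m × 1# - n × 1#                   ≈⟨ cancel-+ˡ-difference 1# _ _ ⟨
    (1# + m × 1#) - (1# + n × 1#)     ≈⟨ +-cong (1+× m 1#) (-‿cong (1+× n 1#)) ⟨
    suc m × 1# - suc n × 1#           ∎

  ι-+ : ∀ i j → ι (i +ℤ j) ≈ ι i + ι j
  ι-+ -[1+ m ] -[1+ n ] = begin
    - (suc (suc (m +ℕ n)) × 1#)       ≡⟨ ≡.cong (λ k → - (k × 1#)) (≡.sym (ℕP.+-suc (suc m) n)) ⟩
    - ((suc m +ℕ suc n) × 1#)         ≈⟨ -‿cong (×-homo-+ 1# (suc m) (suc n)) ⟩
    - (suc m × 1# + suc n × 1#)       ≈⟨ ⁻¹-∙-comm _ _ ⟨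
    - (suc m × 1#) - (suc n × 1#)     ∎
  ι-+ -[1+ m ] (+ n)    = trans (ι-⊖ n (suc m)) (+-comm _ _)
  ι-+ (+ m)    -[1+ n ] = ι-⊖ m (suc n)
  ι-+ (+ m)    (+ n)    = ×-homo-+ 1# m n

  ι-* : ∀ i j → ι (i *ℤ j) ≈ ι i * ι j
  ι-* +0       j        = sym (zeroˡ _)
  ι-* +[1+ m ] +0       = trans (ι-cong (ℤP.*-zeroʳ +[1+ m ])) (sym (zeroʳ _))
  ι-* -[1+ m ] +0       = trans (ι-cong (ℤP.*-zeroʳ -[1+ m ])) (sym (zeroʳ _))
  ι-* +[1+ m ] +[1+ n ] = ×1-homo-* (suc m) (suc n)
  ι-* +[1+ m ] -[1+ n ] = trans (-‿cong (×1-homo-* (suc m) (suc n))) (-‿distribʳ-* _ _)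
  ι-* -[1+ m ] +[1+ n ] = trans (-‿cong (×1-homo-* (suc m) (suc n))) (-‿distribˡ-* _ _)
  ι-* -[1+ m ] -[1+ n ] = begin
    (suc m *ℕ suc n) × 1#             ≈⟨ ×1-homo-* (suc m) (suc n) ⟩
    (suc m × 1#) * (suc n × 1#)       ≈⟨ -‿involutive _ ⟨
    - - ((suc m × 1#) * (suc n × 1#)) ≈⟨ -‿cong (-‿distribˡ-* _ _) ⟩
    - (- (suc m × 1#) * (suc n × 1#)) ≈⟨ -‿distribʳ-* _ _ ⟩
    - (suc m × 1#) * - (suc n × 1#)   ∎

  ι-morphism : CommutativeRing.rawRing ℤP.+-*-commutativeRing -Raw-AlmostCommutative⟶ fromCommutativeRing R
  ι-morphism = record
    { ⟦_⟧ = ι ; +-homo = ι-+ ; *-homo = ι-* ; -‿homo = ι-neg ; 0-homo = refl ; 1-homo = refl }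

  ι-equal? : ∀ i j → Maybe (ι i ≈ ι j)
  ι-equal? i j with i ≟ j
  ... | yes i≡j = just (ι-cong i≡j)
  ... | no  _   = nothing

  open import Algebra.Solver.Ring _ _ ι-morphism ι-equal? public

  :0 :1 : ∀ {n} → Polynomial n
  :0 = con (+ 0)
  :1 = con (+ 1)

module IndexedFromOne {c ℓ} (R : CommutativeRing c ℓ) where
  open CommutativeRing R hiding (zero)

  ∑₁ : ℕ → (ℕ → Carrier) → Carrier
  ∑₁ zero    F = 0#
  ∑₁ (suc M) F = ∑₁ M F + F (suc M)

  ∏₁ : ℕ → (ℕ → Carrier) → Carrier
  ∏₁ zero    h = 1#
  ∏₁ (suc n) h = ∏₁ n h * h (suc n)

  ∑₁-cong : ∀ M {F G : ℕ → Carrier} → (∀ m → F (suc m) ≈ G (suc m)) → ∑₁ M F ≈ ∑₁ M G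
  ∑₁-cong zero    F≈G = refl
  ∑₁-cong (suc M) F≈G = +-cong (∑₁-cong M F≈G) (F≈G M)

  ∑₁-distribˡ : ∀ M a (F : ℕ → Carrier) → a * ∑₁ M F ≈ ∑₁ M (λ m → a * F m)
  ∑₁-distribˡ zero    a F = zeroʳ a
  ∑₁-distribˡ (suc M) a F = trans (distribˡ a _ _) (+-congʳ (∑₁-distribˡ M a F))

  ∏₁-unfoldˡ : ∀ n (h : ℕ → Carrier) → ∏₁ (suc n) h ≈ h 1 * ∏₁ n (λ i → h (suc i))
  ∏₁-unfoldˡ zero    h = trans (*-identityˡ (h 1)) (sym (*-identityʳ (h 1)))
  ∏₁-unfoldˡ (suc n) h = trans (*-congʳ (∏₁-unfoldˡ n h)) (*-assoc _ _ _)

module PowerSeries {c ℓ} (R : CommutativeRing c ℓ) where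
  open CommutativeRing R hiding (zero)
  open import Algebra.Properties.Ring ring using (-0#≈0#)
  open import Relation.Binary.Reasoning.Setoid setoid

  Σ≤ : ℕ → (ℕ → Carrier) → Carrier
  Σ≤ zero    F = F zero
  Σ≤ (suc n) F = Σ≤ n F + F (suc n)

  Σ≤-cong : ∀ n {F G : ℕ → Carrier} → (∀ i → i ≤ n → F i ≈ G i) → Σ≤ n F ≈ Σ≤ n G
  Σ≤-cong zero    F≈G = F≈G zero z≤n
  Σ≤-cong (suc n) F≈G = +-cong (Σ≤-cong n (λ i i≤n → F≈G i (ℕP.m≤n⇒m≤1+n i≤n))) (F≈G (suc n) ℕP.≤-refl)

  Σ≤-zero : ∀ n {F : ℕ → Carrier} → (∀ i → i ≤ n → F i ≈ 0#) → Σ≤ n F ≈ 0#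
  Σ≤-zero zero    F≈0 = F≈0 zero z≤n
  Σ≤-zero (suc n) F≈0 =
    trans (+-cong (Σ≤-zero n (λ i i≤n → F≈0 i (ℕP.m≤n⇒m≤1+n i≤n))) (F≈0 (suc n) ℕP.≤-refl)) (+-identityʳ 0#)

  Σ≤-+ : ∀ n (F G : ℕ → Carrier) → Σ≤ n (λ i → F i + G i) ≈ Σ≤ n F + Σ≤ n G
  Σ≤-+ zero    F G = refl
  Σ≤-+ (suc n) F G = trans (+-congʳ (Σ≤-+ n F G)) (interchange _ _ _ _)
    where open import Algebra.Properties.CommutativeSemigroup +-commutativeSemigroup using (interchange)

  Σ≤-distribˡ : ∀ n a (F : ℕ → Carrier) → a * Σ≤ n F ≈ Σ≤ n (λ i → a * F i)
  Σ≤-distribˡ zero    a F = refl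
  Σ≤-distribˡ (suc n) a F = trans (distribˡ _ _ _) (+-congʳ (Σ≤-distribˡ n a F))

  Σ≤-distribʳ : ∀ n a (F : ℕ → Carrier) → Σ≤ n F * a ≈ Σ≤ n (λ i → F i * a)
  Σ≤-distribʳ zero    a F = refl
  Σ≤-distribʳ (suc n) a F = trans (distribʳ _ _ _) (+-congʳ (Σ≤-distribʳ n a F))

  Σ≤-unfoldˡ : ∀ n (F : ℕ → Carrier) → Σ≤ (suc n) F ≈ F 0 + Σ≤ n (λ i → F (suc i))
  Σ≤-unfoldˡ zero    F = refl
  Σ≤-unfoldˡ (suc n) F = trans (+-congʳ (Σ≤-unfoldˡ n F)) (+-assoc _ _ _)

  Σ≤-reverse : ∀ n (F : ℕ → Carrier) → Σ≤ n F ≈ Σ≤ n (λ i → F (n ∸ i))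
  Σ≤-reverse zero    F = refl
  Σ≤-reverse (suc n) F = begin
    Σ≤ n F + F (suc n)                    ≈⟨ +-comm _ _ ⟩
    F (suc n) + Σ≤ n F                    ≈⟨ +-congˡ (Σ≤-reverse n F) ⟩
    F (suc n) + Σ≤ n (λ i → F (n ∸ i))    ≈⟨ Σ≤-unfoldˡ n (λ i → F (suc n ∸ i)) ⟨
    Σ≤ (suc n) (λ i → F (suc n ∸ i))      ∎

  Σ≤-triangle : ∀ n (T : ℕ → ℕ → Carrier) →
                Σ≤ n (λ i → Σ≤ i (λ j → T j (i ∸ j))) ≈ Σ≤ n (λ j → Σ≤ (n ∸ j) (T j))
  Σ≤-triangle zero    T = refl
  Σ≤-triangle (suc n) T = begin
    Σ≤ n (λ i → Σ≤ i (λ j → T j (i ∸ j))) + (Σ≤ n (λ j → T j (suc n ∸ j)) + T (suc n) (n ∸ n))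
      ≈⟨ +-congʳ (Σ≤-triangle n T) ⟩
    Σ≤ n (λ j → Σ≤ (n ∸ j) (T j)) + (Σ≤ n (λ j → T j (suc n ∸ j)) + T (suc n) (n ∸ n))
      ≈⟨ +-assoc _ _ _ ⟨
    (Σ≤ n (λ j → Σ≤ (n ∸ j) (T j)) + Σ≤ n (λ j → T j (suc n ∸ j))) + T (suc n) (n ∸ n)
      ≈⟨ +-congʳ (Σ≤-+ n _ _) ⟨
    Σ≤ n (λ j → Σ≤ (n ∸ j) (T j) + T j (suc n ∸ j)) + T (suc n) (n ∸ n)
      ≈⟨ +-cong (Σ≤-cong n extend-row) last-row ⟩
    Σ≤ n (λ j → Σ≤ (suc n ∸ j) (T j)) + Σ≤ (suc n ∸ suc n) (T (suc n))
      ∎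
    where
    extend-row : ∀ j → j ≤ n → Σ≤ (n ∸ j) (T j) + T j (suc n ∸ j) ≈ Σ≤ (suc n ∸ j) (T j)
    extend-row j j≤n rewrite ℕP.+-∸-assoc 1 j≤n = refl
    last-row : T (suc n) (n ∸ n) ≈ Σ≤ (n ∸ n) (T (suc n))
    last-row rewrite ℕP.n∸n≡0 n = refl

  Series : Set c
  Series = ℕ → Carrier

  -- coefficientwise equality (a record, so that its arguments are inferable)
  infix 4 _≈ₛ_
  record _≈ₛ_ (f g : Series) : Set ℓ where
    constructor mk≈
    field at : ∀ n → f n ≈ g n
  open _≈ₛ_ public

  infixl 6 _+ₛ_
  infixl 7 _*ₛ_

  _+ₛ_ : Series → Series → Series
  (f +ₛ g) n = f n + g n

  -ₛ_ : Series → Series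
  (-ₛ f) n = - f n

  0ₛ : Series
  0ₛ _ = 0#

  1ₛ : Series
  1ₛ zero    = 1#
  1ₛ (suc _) = 0#

  -- The Cauchy product is kept opaque: unfolded, (f *ₛ g) n is an η-expanded
  -- sum, against which Agda cannot infer implicit arguments of the ring laws.
  opaque
    _*ₛ_ : Series → Series → Series
    (f *ₛ g) n = Σ≤ n (λ i → f i * g (n ∸ i))

    *ₛ-coeff : ∀ f g n → (f *ₛ g) n ≡.≡ Σ≤ n (λ i → f i * g (n ∸ i))
    *ₛ-coeff f g n = ≡.refl

    *ₛ-cong : ∀ {f f′ g g′} → f ≈ₛ f′ → g ≈ₛ g′ → f *ₛ g ≈ₛ f′ *ₛ g′
    *ₛ-cong f≈f′ g≈g′ = mk≈ λ n → Σ≤-cong n (λ i _ → *-cong (at f≈f′ i) (at g≈g′ (n ∸ i)))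

    *ₛ-comm : ∀ f g → f *ₛ g ≈ₛ g *ₛ f
    *ₛ-comm f g = mk≈ λ n → trans (Σ≤-reverse n _) (Σ≤-cong n λ i i≤n →
      trans (*-congˡ (reflexive (≡.cong g (ℕP.m∸[m∸n]≡n i≤n)))) (*-comm _ _))

    *ₛ-identityˡ : ∀ f → 1ₛ *ₛ f ≈ₛ f
    *ₛ-identityˡ f = mk≈ λ where
      zero    → *-identityˡ (f 0)
      (suc n) → begin
        Σ≤ (suc n) (λ i → 1ₛ i * f (suc n ∸ i))       ≈⟨ Σ≤-unfoldˡ n _ ⟩
        1# * f (suc n) + Σ≤ n (λ i → 0# * f (n ∸ i))  ≈⟨ +-cong (*-identityˡ _) (Σ≤-zero n (λ i _ → zeroˡ _)) ⟩
        f (suc n) + 0#                                ≈⟨ +-identityʳ _ ⟩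
        f (suc n)                                     ∎

    *ₛ-distribʳ : ∀ f g h → (g +ₛ h) *ₛ f ≈ₛ g *ₛ f +ₛ h *ₛ f
    *ₛ-distribʳ f g h = mk≈ λ n → trans (Σ≤-cong n (λ i _ → distribʳ _ _ _)) (Σ≤-+ n _ _)

    -- Associativity: both sides equal Σ_{j+k+l=n} f_j g_k h_l.
    *ₛ-assoc : ∀ f g h → (f *ₛ g) *ₛ h ≈ₛ f *ₛ (g *ₛ h)
    *ₛ-assoc f g h = mk≈ λ n → begin
      Σ≤ n (λ i → Σ≤ i (λ j → f j * g (i ∸ j)) * h (n ∸ i))
        ≈⟨ Σ≤-cong n (λ i _ → Σ≤-distribʳ i _ _) ⟩
      Σ≤ n (λ i → Σ≤ i (λ j → (f j * g (i ∸ j)) * h (n ∸ i)))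
        ≈⟨ Σ≤-cong n (λ i i≤n → Σ≤-cong i (λ j j≤i →
             *-congˡ (reflexive (≡.cong (λ k → h (n ∸ k)) (≡.sym (ℕP.m+[n∸m]≡n j≤i)))))) ⟩
      Σ≤ n (λ i → Σ≤ i (λ j → T n j (i ∸ j)))
        ≈⟨ Σ≤-triangle n (T n) ⟩
      Σ≤ n (λ j → Σ≤ (n ∸ j) (T n j))
        ≈⟨ Σ≤-cong n (λ j _ → Σ≤-cong (n ∸ j) (λ k _ → trans (*-assoc _ _ _)
             (*-congˡ (*-congˡ (reflexive (≡.cong h (≡.sym (ℕP.∸-+-assoc n j k)))))))) ⟩
      Σ≤ n (λ j → Σ≤ (n ∸ j) (λ k → f j * (g k * h (n ∸ j ∸ k))))
        ≈⟨ Σ≤-cong n (λ j _ → Σ≤-distribˡ (n ∸ j) _ _) ⟨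
      Σ≤ n (λ j → f j * Σ≤ (n ∸ j) (λ k → g k * h (n ∸ j ∸ k)))
        ∎
      where
      T : ℕ → ℕ → ℕ → Carrier
      T n j k = (f j * g k) * h (n ∸ (j +ℕ k))

  seriesRing : CommutativeRing c ℓ
  seriesRing = record
    { Carrier = Series ; _≈_ = _≈ₛ_ ; _+_ = _+ₛ_ ; _*_ = _*ₛ_ ; -_ = -ₛ_ ; 0# = 0ₛ ; 1# = 1ₛ
    ; isCommutativeRing = record
      { isRing = record
        { +-isAbelianGroup = record
          { isGroup = record
            { isMonoid = record
              { isSemigroup = record
                { isMagma = record
                  { isEquivalence = record
                    { refl  = mk≈ λ n → refl
                    ; sym   = λ f≈g → mk≈ λ n → sym (at f≈g n)
                    ; trans = λ f≈g g≈h → mk≈ λ n → trans (at f≈g n) (at g≈h n) }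
                  ; ∙-cong = λ f≈f′ g≈g′ → mk≈ λ n → +-cong (at f≈f′ n) (at g≈g′ n) }
                ; assoc = λ f g h → mk≈ λ n → +-assoc _ _ _ }
              ; identity = (λ f → mk≈ λ n → +-identityˡ _) , (λ f → mk≈ λ n → +-identityʳ _) }
            ; inverse = (λ f → mk≈ λ n → -‿inverseˡ _) , (λ f → mk≈ λ n → -‿inverseʳ _)
            ; ⁻¹-cong = λ f≈g → mk≈ λ n → -‿cong (at f≈g n) }
          ; comm = λ f g → mk≈ λ n → +-comm _ _ }
        ; *-cong = *ₛ-cong
        ; *-assoc = *ₛ-assoc
        ; *-identity = *ₛ-identityˡ , (λ f → trans≈ₛ (*ₛ-comm f 1ₛ) (*ₛ-identityˡ f))
        ; distrib = (λ f g h → trans≈ₛ (*ₛ-comm f (g +ₛ h)) (trans≈ₛ (*ₛ-distribʳ f g h)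
                       (mk≈ λ n → +-cong (at (*ₛ-comm g f) n) (at (*ₛ-comm h f) n))))
                    , *ₛ-distribʳ }
      ; *-comm = *ₛ-comm } }
    where
    trans≈ₛ : ∀ {f g h} → f ≈ₛ g → g ≈ₛ h → f ≈ₛ h
    trans≈ₛ f≈g g≈h = mk≈ λ n → trans (at f≈g n) (at g≈h n)

  open IndexedFromOne seriesRing using (∑₁; ∏₁)
  open import Algebra.Properties.CommutativeSemiring.Exp (CommutativeRing.commutativeSemiring seriesRing)
    using (_^_)

  infixl 6 _-ₛ_
  _-ₛ_ : Series → Series → Series
  f -ₛ g = f +ₛ (-ₛ g)

  HasOrder : ℕ → Series → Set ℓ
  HasOrder n f = ∀ i → i < n → f i ≈ 0#

  HasOrder-resp : ∀ {n f g} → f ≈ₛ g → HasOrder n f → HasOrder n g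
  HasOrder-resp f≈g ord i i<n = trans (sym (at f≈g i)) (ord i i<n)

  HasOrder-mono : ∀ {m n f} → m ≤ n → HasOrder n f → HasOrder m f
  HasOrder-mono m≤n ord i i<m = ord i (ℕP.<-≤-trans i<m m≤n)

  HasOrder-0 : ∀ f → HasOrder 0 f
  HasOrder-0 f i ()

  HasOrder-+ : ∀ {n f g} → HasOrder n f → HasOrder n g → HasOrder n (f +ₛ g)
  HasOrder-+ ord-f ord-g i i<n = trans (+-cong (ord-f i i<n) (ord-g i i<n)) (+-identityʳ 0#)

  HasOrder-neg : ∀ {n f} → HasOrder n f → HasOrder n (-ₛ f)
  HasOrder-neg ord i i<n = trans (-‿cong (ord i i<n)) -0#≈0#

  -- Orders add under multiplication: in f_j g_{i-j} with i < m + n,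
  -- either j < m or i - j < n.
  HasOrder-* : ∀ {m n f g} → HasOrder m f → HasOrder n g → HasOrder (m +ℕ n) (f *ₛ g)
  HasOrder-* {m} {n} {f} {g} ord-f ord-g i i<m+n = trans (reflexive (*ₛ-coeff f g i)) (Σ≤-zero i term-vanishes)
    where
    term-vanishes : ∀ j → j ≤ i → f j * g (i ∸ j) ≈ 0#
    term-vanishes j j≤i with j ℕP.<? m
    ... | yes j<m = trans (*-congʳ (ord-f j j<m)) (zeroˡ _)
    ... | no  j≮m = trans (*-congˡ (ord-g (i ∸ j) i∸j<n)) (zeroʳ _)
      where
      i∸j<n : i ∸ j < n
      i∸j<n = ℕP.≤-<-trans (ℕP.∸-monoʳ-≤ i (ℕP.≮⇒≥ j≮m))
                (≡.subst (i ∸ m <_) (ℕP.m+n∸m≡n m n) (ℕP.∸-monoˡ-< i<m+n (ℕP.≤-trans (ℕP.≮⇒≥ j≮m) j≤i)))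

  HasOrder-∏₁ : ∀ n (h : ℕ → Series) → (∀ i → HasOrder 1 (h i)) → HasOrder n (∏₁ n h)
  HasOrder-∏₁ zero    h ord = HasOrder-0 _
  HasOrder-∏₁ (suc n) h ord =
    HasOrder-mono (ℕP.≤-reflexive (ℕP.+-comm 1 n)) (HasOrder-* (HasOrder-∏₁ n h ord) (ord (suc n)))

  HasOrder-∑₁ : ∀ n M (F : ℕ → Series) → (∀ m → HasOrder n (F (suc m))) → HasOrder n (∑₁ M F)
  HasOrder-∑₁ n zero    F ord i i<n = refl
  HasOrder-∑₁ n (suc M) F ord       = HasOrder-+ (HasOrder-∑₁ n M F ord) (ord M)

  -- Series congruent to 1 modulo x (the constant term is 1).  They form a
  -- multiplicative monoid, because 1 - ab = (1 - a) + a(1 - b).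
  IsOneModX : Series → Set ℓ
  IsOneModX a = HasOrder 1 (1ₛ -ₛ a)

  oneModX-1- : ∀ {b} → HasOrder 1 b → IsOneModX (1ₛ -ₛ b)
  oneModX-1- {b} = HasOrder-resp (b≈1-[1-b] b)
    where
    open IntegerCoefficients seriesRing using (solve; _:-_; _:=_; :1)
    b≈1-[1-b] : ∀ b → b ≈ₛ 1ₛ -ₛ (1ₛ -ₛ b)
    b≈1-[1-b] = solve 1 (λ b → b := :1 :- (:1 :- b)) (CommutativeRing.refl seriesRing)

  oneModX-* : ∀ {a b} → IsOneModX a → IsOneModX b → IsOneModX (a *ₛ b)
  oneModX-* {a} {b} ord-a ord-b =
    HasOrder-resp (split a b) (HasOrder-+ ord-a (HasOrder-* {0} {1} (HasOrder-0 a) ord-b))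
    where
    open IntegerCoefficients seriesRing using (solve; _:+_; _:*_; _:-_; _:=_; :1)
    split : ∀ a b → (1ₛ -ₛ a) +ₛ a *ₛ (1ₛ -ₛ b) ≈ₛ 1ₛ -ₛ a *ₛ b
    split = solve 2 (λ a b → (:1 :- a) :+ a :* (:1 :- b) := :1 :- a :* b)
                    (CommutativeRing.refl seriesRing)

  oneModX-^ : ∀ {a} n → IsOneModX a → IsOneModX (a ^ n)
  oneModX-^ zero    ord-a i i<1 = -‿inverseʳ (1ₛ i)
  oneModX-^ (suc n) ord-a = oneModX-* ord-a (oneModX-^ n ord-a)

  ∑₁-stable : (F : ℕ → Series) → (∀ m → HasOrder m (F m)) →
              ∀ a M → suc a ≤ M → ∑₁ M F a ≈ ∑₁ (suc a) F a
  ∑₁-stable F ord a M a<M = begin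
    ∑₁ M F a                     ≡⟨ ≡.cong (λ N → ∑₁ N F a) (≡.sym (ℕP.m∸n+n≡m a<M)) ⟩
    ∑₁ (M ∸ suc a +ℕ suc a) F a  ≈⟨ stable-after (M ∸ suc a) ⟩
    ∑₁ (suc a) F a               ∎
    where
    stable-after : ∀ k → ∑₁ (k +ℕ suc a) F a ≈ ∑₁ (suc a) F a
    stable-after zero    = refl
    stable-after (suc k) =
      trans (+-congˡ (ord (suc (k +ℕ suc a)) a (s≤s (ℕP.<⇒≤ (ℕP.m≤n+m (suc a) k)))))
            (trans (+-identityʳ _) (stable-after k))

  coeff-agree : ∀ {f g h} a → f ≈ₛ g +ₛ h → HasOrder (suc a) h → f a ≈ g a
  coeff-agree a f≈g+h ord-h = trans (at f≈g+h a) (trans (+-congˡ (ord-h a ℕP.≤-refl)) (+-identityʳ _))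

  xₛ : Series
  xₛ (suc zero) = 1#
  xₛ _          = 0#

  -- 1 + x + x² + ⋯ is the inverse of 1 - x: the partial sums of the
  -- coefficients of 1 - x are 1, 0, 0, …
  geometric : Series
  geometric _ = 1#

  geometric-inverse : (1ₛ -ₛ xₛ) *ₛ geometric ≈ₛ 1ₛ
  geometric-inverse = mk≈ λ n → trans (reflexive (*ₛ-coeff (1ₛ -ₛ xₛ) geometric n))
                                  (trans (Σ≤-cong n (λ i _ → *-identityʳ _)) (partial-sums n))
    where
    0-0≈0 : 0# - 0# ≈ 0#
    0-0≈0 = -‿inverseʳ 0#
    partial-sums : ∀ n → Σ≤ n (1ₛ -ₛ xₛ) ≈ 1ₛ n
    partial-sums zero             = trans (+-congˡ -0#≈0#) (+-identityʳ 1#)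
    partial-sums (suc zero)       = trans (+-cong (partial-sums zero) (+-identityˡ (- 1#))) (-‿inverseʳ 1#)
    partial-sums (suc (suc n))    = trans (+-cong (partial-sums (suc n)) 0-0≈0) (+-identityʳ 0#)

-- For fixed
-- q, w put A n = ∏_{i=1}^{n} (1 - qⁱ), B n = ∏_{i=1}^{n} (1 - qⁱ w) and
--   S X M = Σ_{m=1}^{M+1} Xᵐ A_{m-1},
-- a partial sum of the left-hand side divided by zt (for X = 1/(1 - zt)).
module Telescoping {c ℓ} (R : CommutativeRing c ℓ) (q w : CommutativeRing.Carrier R) where
  open CommutativeRing R hiding (zero)
  open IndexedFromOne R using (∑₁; ∏₁)
  open import Algebra.Properties.CommutativeSemiring.Exp commutativeSemiring using (_^_; ^-congˡ; ^-distrib-*)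
  open IntegerCoefficients R using (solve; _:+_; _:*_; _:-_; _:=_; :0; :1)
  open import Relation.Binary.Reasoning.Setoid setoid

  A : ℕ → Carrier
  A n = ∏₁ n (λ i → 1# - q ^ i)

  B : ℕ → Carrier
  B n = ∏₁ n (λ i → 1# - q ^ i * w)

  S : Carrier → ℕ → Carrier
  S X M = ∑₁ (suc M) (λ m → X ^ m * A (m ∸ 1))

  -- Replacing X by Xq turns S into 1 + (1 - u)·S, where u = 1/X, up to an
  -- error term of the size of A_{M+1}.  Termwise this is
  -- (Xq)ᵐ A_{m-1} = Xᵐ A_{m-1} - Xᵐ A_m, since qᵐ A_{m-1} = A_{m-1} - A_m.
  S-shift : ∀ X Y u → Y ≈ X * q → u * X ≈ 1# → ∀ M →
            S Y M ≈ 1# + (1# - u) * S X M - X ^ suc M * A (suc M)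
  S-shift X Y u Y≈Xq uX≈1 = shifted
    where
    add-vanishing : ∀ x a → x ≈ x + a * (1# - u * X)
    add-vanishing x a = sym (trans (+-congˡ (trans (*-congˡ (trans (+-congˡ (-‿cong uX≈1)) (-‿inverseʳ 1#)))
                                                   (zeroʳ a)))
                                   (+-identityʳ x))

    Yⁿ≈Xⁿqⁿ : ∀ n → Y ^ n ≈ X ^ n * q ^ n
    Yⁿ≈Xⁿqⁿ n = trans (^-congˡ n Y≈Xq) (^-distrib-* X q n)

    shifted : ∀ M → S Y M ≈ 1# + (1# - u) * S X M - X ^ suc M * A (suc M)
    shifted zero = begin
      0# + (Y * 1#) * 1#            ≈⟨ solve 1 (λ Y → :0 :+ (Y :* :1) :* :1 := Y) refl Y ⟩
      Y                             ≈⟨ Y≈Xq ⟩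
      X * q                         ≈⟨ add-vanishing (X * q) 1# ⟩
      X * q + 1# * (1# - u * X)
        ≈⟨ solve 3 (λ X q u → X :* q :+ :1 :* (:1 :- u :* X)
                   := :1 :+ (:1 :- u) :* (:0 :+ (X :* :1) :* :1) :- (X :* :1) :* (:1 :* (:1 :- q :* :1)))
                   refl X q u ⟩
      1# + (1# - u) * (0# + (X * 1#) * 1#) - (X * 1#) * (1# * (1# - q * 1#)) ∎
    shifted (suc M) = begin
      S Y M + Y ^ suc (suc M) * Z
        ≈⟨ +-cong (shifted M) (*-congʳ (Yⁿ≈Xⁿqⁿ (suc (suc M)))) ⟩
      (1# + (1# - u) * SX - P * Z) + ((X * P) * (q * Q)) * Z
        ≈⟨ add-vanishing _ (P * Z) ⟩
      (1# + (1# - u) * SX - P * Z) + ((X * P) * (q * Q)) * Z + (P * Z) * (1# - u * X)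
        ≈⟨ solve 7 (λ u SX P X Z Q q →
             (:1 :+ (:1 :- u) :* SX :- P :* Z) :+ ((X :* P) :* (q :* Q)) :* Z :+ (P :* Z) :* (:1 :- u :* X)
             := :1 :+ (:1 :- u) :* (SX :+ (X :* P) :* Z) :- (X :* P) :* (Z :* (:1 :- q :* Q)))
             refl u SX P X Z Q q ⟩
      1# + (1# - u) * (SX + (X * P) * Z) - (X * P) * (Z * (1# - q * Q)) ∎
      where
      SX P Z Q : Carrier
      SX = S X M
      P  = X ^ suc M
      Z  = A (suc M)
      Q  = q ^ suc M

  -- Unrolling: let X_0 = 1/w and X_{j+1} = X_j / q.  Applying S-shift with
  -- u = q^{j+1} w to each X_j expresses S X_0 as Σ_k B_k, plus B_{J+1} S X_{J+1}
  -- and accumulated error terms B_k E_k, all of the size of B_{J+1} or A_{M+1}.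
  module Unrolling (X : ℕ → Carrier) (X₀w≈1 : X 0 * w ≈ 1#) (Xⱼ≈Xⱼ₊₁q : ∀ j → X j ≈ X (suc j) * q) where

    qʲXⱼ≈X₀ : ∀ j → q ^ j * X j ≈ X 0
    qʲXⱼ≈X₀ zero    = *-identityˡ (X 0)
    qʲXⱼ≈X₀ (suc j) = begin
      (q * q ^ j) * X (suc j)  ≈⟨ solve 3 (λ q Q X → (q :* Q) :* X := Q :* (X :* q)) refl q (q ^ j) (X (suc j)) ⟩
      q ^ j * (X (suc j) * q)  ≈⟨ *-congˡ (Xⱼ≈Xⱼ₊₁q j) ⟨
      q ^ j * X j              ≈⟨ qʲXⱼ≈X₀ j ⟩
      X 0                      ∎

    uⱼXⱼ₊₁≈1 : ∀ j → (q ^ suc j * w) * X (suc j) ≈ 1#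
    uⱼXⱼ₊₁≈1 j = begin
      (q ^ suc j * w) * X (suc j)  ≈⟨ solve 3 (λ Q w X → (Q :* w) :* X := (Q :* X) :* w) refl (q ^ suc j) w (X (suc j)) ⟩
      (q ^ suc j * X (suc j)) * w  ≈⟨ *-congʳ (qʲXⱼ≈X₀ (suc j)) ⟩
      X 0 * w                      ≈⟨ X₀w≈1 ⟩
      1#                           ∎

    E : ℕ → ℕ → Carrier
    E k M = X (suc k) ^ suc M * A (suc M)

    step : ∀ j M → S (X j) M ≈ 1# + (1# - q ^ suc j * w) * S (X (suc j)) M - E j M
    step j M = S-shift (X (suc j)) (X j) (q ^ suc j * w) (Xⱼ≈Xⱼ₊₁q j) (uⱼXⱼ₊₁≈1 j) M

    Bsum : ℕ → Carrier
    Bsum J = ∑₁ (suc J) (λ m → B (m ∸ 1))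

    Esum : ℕ → ℕ → Carrier
    Esum J M = ∑₁ (suc J) (λ m → B (m ∸ 1) * E (m ∸ 1) M)

    unroll : ∀ M J → S (X 0) M ≈ Bsum J + B (suc J) * S (X (suc J)) M - Esum J M
    unroll M zero = begin
      S (X 0) M                                ≈⟨ step 0 M ⟩
      1# + (1# - q ^ 1 * w) * S (X 1) M - E 0 M
        ≈⟨ solve 3 (λ c S e → :1 :+ c :* S :- e := (:0 :+ :1) :+ (:1 :* c) :* S :- (:0 :+ :1 :* e))
                   refl (1# - q ^ 1 * w) (S (X 1) M) (E 0 M) ⟩
      Bsum 0 + B 1 * S (X 1) M - Esum 0 M      ∎
    unroll M (suc J) = begin
      S (X 0) M                                            ≈⟨ unroll M J ⟩
      Bsum J + Bⱼ * S (X (suc J)) M - Esum J M             ≈⟨ +-congʳ (+-congˡ (*-congˡ (step (suc J) M))) ⟩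
      Bsum J + Bⱼ * (1# + f * S′ - e) - Esum J M
        ≈⟨ solve 6 (λ K Bⱼ c S′ e Eₛ → K :+ Bⱼ :* (:1 :+ c :* S′ :- e) :- Eₛ
                                      := (K :+ Bⱼ) :+ (Bⱼ :* c) :* S′ :- (Eₛ :+ Bⱼ :* e))
                   refl (Bsum J) Bⱼ f S′ e (Esum J M) ⟩
      (Bsum J + Bⱼ) + (Bⱼ * f) * S′ - (Esum J M + Bⱼ * e)  ∎
      where
      Bⱼ f S′ e : Carrier
      Bⱼ = B (suc J)
      f  = 1# - q ^ suc (suc J) * w
      S′ = S (X (suc (suc J))) M
      e  = E (suc J) M

open import Defs
open import Data.Integer using (ℤ) renaming (_+_ to _+ℤ_)
open import Data.Product using (∃; _×_)

-- PS is ℤ[[z]][[t]]: the coefficient f a of tᵃ is a power series in z.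
module ℤ⟦z⟧ = PowerSeries ℤP.+-*-commutativeRing
module ℤ⟦z⟧⟦t⟧ = PowerSeries ℤ⟦z⟧.seriesRing

open ℤ⟦z⟧⟦t⟧ using (_≈ₛ_; mk≈; _+ₛ_; _*ₛ_; _-ₛ_; 1ₛ; HasOrder; HasOrder-resp; HasOrder-mono; HasOrder-0;
  HasOrder-+; HasOrder-neg; HasOrder-*; HasOrder-∏₁; HasOrder-∑₁; IsOneModX; oneModX-1-; oneModX-*; oneModX-^)
open CommutativeRing ℤ⟦z⟧⟦t⟧.seriesRing using (setoid; +-cong; +-congʳ; -‿cong; *-cong; *-congˡ; *-congʳ;
  *-comm; *-assoc; *-identityʳ)
  renaming (refl to ≈ₛ-refl; sym to ≈ₛ-sym; trans to ≈ₛ-trans)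
open IndexedFromOne ℤ⟦z⟧⟦t⟧.seriesRing using (∑₁; ∏₁)
open import Algebra.Properties.CommutativeSemiring.Exp (CommutativeRing.commutativeSemiring ℤ⟦z⟧⟦t⟧.seriesRing)
  using (_^_)

toRing : ∀ {f g} → f ≈ g → f ≈ₛ g
toRing f≈g = mk≈ λ a → ℤ⟦z⟧.mk≈ (f≈g a)

sumUpTo-cong : ∀ n {h k : ℕ → ℤ} → (∀ i → h i ≡.≡ k i) → sumUpTo n h ≡.≡ sumUpTo n k
sumUpTo-cong zero    h≡k = h≡k zero
sumUpTo-cong (suc n) h≡k = ≡.cong₂ _+ℤ_ (sumUpTo-cong n h≡k) (h≡k (suc n))

Σ≤ℤ≡sumUpTo : ∀ n h → ℤ⟦z⟧.Σ≤ n h ≡.≡ sumUpTo n h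
Σ≤ℤ≡sumUpTo zero    h = ≡.refl
Σ≤ℤ≡sumUpTo (suc n) h = ≡.cong (_+ℤ h (suc n)) (Σ≤ℤ≡sumUpTo n h)

Σ≤-coeff : ∀ a (F : ℕ → ℕ → ℤ) b → ℤ⟦z⟧⟦t⟧.Σ≤ a F b ≡.≡ sumUpTo a (λ i → F i b)
Σ≤-coeff zero    F b = ≡.refl
Σ≤-coeff (suc a) F b = ≡.cong (_+ℤ F (suc a) b) (Σ≤-coeff a F b)

⊛≈*ₛ : ∀ f g → f ⊛ g ≈ₛ f *ₛ g
⊛≈*ₛ f g = toRing λ a b → ≡.sym (begin
  (f *ₛ g) a b
    ≡⟨ ≡.cong (λ h → h b) (ℤ⟦z⟧⟦t⟧.*ₛ-coeff f g a) ⟩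
  ℤ⟦z⟧⟦t⟧.Σ≤ a (λ i → f i ℤ⟦z⟧.*ₛ g (a ∸ i)) b
    ≡⟨ Σ≤-coeff a _ b ⟩
  sumUpTo a (λ i → (f i ℤ⟦z⟧.*ₛ g (a ∸ i)) b)
    ≡⟨ sumUpTo-cong a (λ i → ≡.trans (ℤ⟦z⟧.*ₛ-coeff (f i) (g (a ∸ i)) b) (Σ≤ℤ≡sumUpTo b _)) ⟩
  (f ⊛ g) a b ∎)
  where open ≡.≡-Reasoning

onePS≈1ₛ : onePS ≈ₛ 1ₛ
onePS≈1ₛ = toRing λ where
  zero    zero    → ≡.refl
  zero    (suc b) → ≡.refl
  (suc a) b       → ≡.refl

1⊖-cong : ∀ {f f′} → f ≈ₛ f′ → onePS ⊖ f ≈ₛ 1ₛ -ₛ f′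
1⊖-cong f≈f′ = +-cong onePS≈1ₛ (-‿cong f≈f′)

powPS≈^ : ∀ {f f′} n → f ≈ₛ f′ → powPS f n ≈ₛ f′ ^ n
powPS≈^ zero    f≈f′ = onePS≈1ₛ
powPS≈^ {f} {f′} (suc n) f≈f′ =
  ≈ₛ-trans (⊛≈*ₛ (powPS f n) f) (≈ₛ-trans (*-cong (powPS≈^ n f≈f′) f≈f′) (*-comm (f′ ^ n) f′))

prodFrom1≈∏₁ : ∀ n {h k : ℕ → PS} → (∀ i → h i ≈ₛ k i) → prodFrom1 n h ≈ₛ ∏₁ n k
prodFrom1≈∏₁ zero    h≈k = onePS≈1ₛ
prodFrom1≈∏₁ (suc n) {h} h≈k = ≈ₛ-trans (⊛≈*ₛ (prodFrom1 n h) (h (suc n))) (*-cong (prodFrom1≈∏₁ n h≈k) (h≈k (suc n)))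

partialSum1≡∑₁ : ∀ M F → partialSum1 M F ≡.≡ ∑₁ M F
partialSum1≡∑₁ zero    F = ≡.refl
partialSum1≡∑₁ (suc M) F = ≡.cong (_⊕ F (suc M)) (partialSum1≡∑₁ M F)

partialSum1-coeff : ∀ M F a b → partialSum1 M F a b ≡.≡ ∑₁ M F a b
partialSum1-coeff M F a b = ≡.cong (λ S → S a b) (partialSum1≡∑₁ M F)

converges : (F : ℕ → PS) → (∀ m → HasOrder m (F m)) → HasSum1 F (λ a → partialSum1 (suc a) F a)
converges F ord a b = suc a , λ M a<M →
  ≡.trans (partialSum1-coeff M F a b)
    (≡.trans (ℤ⟦z⟧.at (ℤ⟦z⟧⟦t⟧.∑₁-stable F ord a M a<M) b) (≡.sym (partialSum1-coeff (suc a) F a b)))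

t-order : HasOrder 1 tPS
t-order zero    _         = ℤ⟦z⟧.mk≈ λ b → ≡.refl
t-order (suc i) (s≤s ())

zt-order : HasOrder 1 zt
zt-order = HasOrder-resp (≈ₛ-sym (⊛≈*ₛ zPS tPS)) (HasOrder-* {0} {1} (HasOrder-0 zPS) t-order)

module Identity (g : PS) (g-inverse : g ⊛ (onePS ⊖ zt) ≈ onePS) where
  open import Relation.Binary.Reasoning.Setoid setoid
  open IntegerCoefficients ℤ⟦z⟧⟦t⟧.seriesRing using (solve; _:+_; _:*_; _:-_; _:=_; :1)

  q w : PS
  q = 1ₛ -ₛ tPS
  w = 1ₛ -ₛ zt

  open Telescoping ℤ⟦z⟧⟦t⟧.seriesRing q w

  p : PS
  p = ℤ⟦z⟧⟦t⟧.geometric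

  qp≈1 : q *ₛ p ≈ₛ 1ₛ
  qp≈1 = begin
    (1ₛ -ₛ tPS) *ₛ p            ≈⟨ *-congʳ q≈1-x ⟩
    (1ₛ -ₛ ℤ⟦z⟧⟦t⟧.xₛ) *ₛ p     ≈⟨ ℤ⟦z⟧⟦t⟧.geometric-inverse ⟩
    1ₛ                          ∎
    where
    t≈x : tPS ≈ₛ ℤ⟦z⟧⟦t⟧.xₛ
    t≈x = toRing λ where
      zero          b       → ≡.refl
      (suc zero)    zero    → ≡.refl
      (suc zero)    (suc b) → ≡.refl
      (suc (suc a)) b       → ≡.refl
    q≈1-x : q ≈ₛ 1ₛ -ₛ ℤ⟦z⟧⟦t⟧.xₛ
    q≈1-x = +-cong (≈ₛ-refl {1ₛ}) (-‿cong t≈x)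

  -- X_j = g / q^j
  X : ℕ → PS
  X j = g *ₛ p ^ j

  X₀w≈1 : X 0 *ₛ w ≈ₛ 1ₛ
  X₀w≈1 = begin
    (g *ₛ 1ₛ) *ₛ w        ≈⟨ *-congʳ (*-identityʳ g) ⟩
    g *ₛ w                ≈⟨ *-congˡ (1⊖-cong ≈ₛ-refl) ⟨
    g *ₛ (onePS ⊖ zt)     ≈⟨ ⊛≈*ₛ g (onePS ⊖ zt) ⟨
    g ⊛ (onePS ⊖ zt)      ≈⟨ ≈ₛ-trans (toRing g-inverse) onePS≈1ₛ ⟩
    1ₛ                    ∎

  Xⱼ≈Xⱼ₊₁q : ∀ j → X j ≈ₛ X (suc j) *ₛ q
  Xⱼ≈Xⱼ₊₁q j = ≈ₛ-sym (begin
    (g *ₛ (p *ₛ P)) *ₛ q  ≈⟨ solve 4 (λ g p P q → (g :* (p :* P)) :* q := (g :* P) :* (q :* p)) ≈ₛ-refl g p P q ⟩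
    (g *ₛ P) *ₛ (q *ₛ p)  ≈⟨ *-congˡ qp≈1 ⟩
    (g *ₛ P) *ₛ 1ₛ        ≈⟨ *-identityʳ _ ⟩
    g *ₛ P                ∎)
    where
    P : PS
    P = p ^ j

  open Unrolling X X₀w≈1 Xⱼ≈Xⱼ₊₁q

  lhsTerm≈ : ∀ m → lhsTerm g m ≈ₛ zt *ₛ (X 0 ^ m *ₛ A (m ∸ 1))
  lhsTerm≈ m = begin
    lhsTerm g m
      ≈⟨ ⊛≈*ₛ (zt ⊛ powPS g m) _ ⟩
    (zt ⊛ powPS g m) *ₛ prodFrom1 (m ∸ 1) (λ i → onePS ⊖ powPS (onePS ⊖ tPS) i)
      ≈⟨ *-cong (≈ₛ-trans (⊛≈*ₛ zt (powPS g m)) (*-congˡ (powPS≈^ m (≈ₛ-sym (*-identityʳ g)))))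
                (prodFrom1≈∏₁ (m ∸ 1) (λ i → 1⊖-cong (powPS≈^ i (1⊖-cong ≈ₛ-refl)))) ⟩
    (zt *ₛ X 0 ^ m) *ₛ A (m ∸ 1)
      ≈⟨ *-assoc zt _ _ ⟩
    zt *ₛ (X 0 ^ m *ₛ A (m ∸ 1)) ∎

  rhsTerm≈ : ∀ m → rhsTerm m ≈ₛ ∏₁ m (λ i → 1ₛ -ₛ q ^ (i ∸ 1) *ₛ w)
  rhsTerm≈ m = prodFrom1≈∏₁ m λ i → 1⊖-cong (≈ₛ-trans
    (⊛≈*ₛ (powPS (onePS ⊖ tPS) (i ∸ 1)) (onePS ⊖ zt))
    (*-cong (powPS≈^ (i ∸ 1) (1⊖-cong ≈ₛ-refl)) (1⊖-cong ≈ₛ-refl)))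

  -- the first factor of the right-hand product is 1 - w = zt
  rhsTerm-suc : ∀ k → rhsTerm (suc k) ≈ₛ zt *ₛ B k
  rhsTerm-suc k = begin
    rhsTerm (suc k)                                    ≈⟨ rhsTerm≈ (suc k) ⟩
    ∏₁ (suc k) (λ i → 1ₛ -ₛ q ^ (i ∸ 1) *ₛ w)          ≈⟨ ∏₁-unfoldˡ k _ ⟩
    (1ₛ -ₛ 1ₛ *ₛ (1ₛ -ₛ zt)) *ₛ B k                    ≈⟨ *-congʳ (solve 1 (λ s → :1 :- :1 :* (:1 :- s) := s) ≈ₛ-refl zt) ⟩
    zt *ₛ B k                                          ∎
    where open IndexedFromOne ℤ⟦z⟧⟦t⟧.seriesRing using (∏₁-unfoldˡ)

  -- t-orders: q and w are ≡ 1 mod t, so A n and B n have t-order ≥ n.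
  q-oneModT : IsOneModX q
  q-oneModT = oneModX-1- t-order

  w-oneModT : IsOneModX w
  w-oneModT = oneModX-1- zt-order

  A-order : ∀ n → HasOrder n (A n)
  A-order n = HasOrder-∏₁ n _ (λ i → oneModX-^ i q-oneModT)

  B-order : ∀ n → HasOrder n (B n)
  B-order n = HasOrder-∏₁ n _ (λ i → oneModX-* (oneModX-^ i q-oneModT) w-oneModT)

  lhs-order : ∀ m → HasOrder m (lhsTerm g m)
  lhs-order zero    = HasOrder-0 _
  lhs-order (suc k) = HasOrder-resp (≈ₛ-sym (lhsTerm≈ (suc k)))
    (HasOrder-* {1} {k} zt-order (HasOrder-* {0} {k} (HasOrder-0 _) (A-order k)))

  rhs-order : ∀ m → HasOrder m (rhsTerm m)
  rhs-order zero    = HasOrder-0 _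
  rhs-order (suc k) = HasOrder-resp (≈ₛ-sym (rhsTerm-suc k)) (HasOrder-* {1} {k} zt-order (B-order k))

  -- Unrolling M + 1 steps shows that the (M+1)-st partial sums of the two
  -- sides differ by zt·D M, and D M has t-order > M.
  D : ℕ → PS
  D M = B (suc M) *ₛ S (X (suc M)) M -ₛ Esum M M

  D-order : ∀ M → HasOrder (suc M) (D M)
  D-order M = HasOrder-+
    (HasOrder-mono (ℕP.m≤m+n (suc M) 0) (HasOrder-* {suc M} {0} (B-order (suc M)) (HasOrder-0 _)))
    (HasOrder-neg (HasOrder-∑₁ (suc M) (suc M) _ λ m →
      HasOrder-* {0} {suc M} (HasOrder-0 _) (HasOrder-* {0} {suc M} (HasOrder-0 _) (A-order (suc M)))))

  partial-sums-differ : ∀ M → ∑₁ (suc M) (lhsTerm g) ≈ₛ ∑₁ (suc M) rhsTerm +ₛ zt *ₛ D M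
  partial-sums-differ M = begin
    ∑₁ (suc M) (lhsTerm g)
      ≈⟨ ∑₁-cong (suc M) (λ m → lhsTerm≈ (suc m)) ⟩
    ∑₁ (suc M) (λ m → zt *ₛ (X 0 ^ m *ₛ A (m ∸ 1)))
      ≈⟨ ∑₁-distribˡ (suc M) zt _ ⟨
    zt *ₛ S (X 0) M
      ≈⟨ *-congˡ (unroll M M) ⟩
    zt *ₛ (Bsum M +ₛ BS -ₛ Esum M M)
      ≈⟨ solve 4 (λ s K BS E → s :* (K :+ BS :- E) := s :* K :+ s :* (BS :- E)) ≈ₛ-refl zt (Bsum M) BS (Esum M M) ⟩
    zt *ₛ Bsum M +ₛ zt *ₛ D M
      ≈⟨ +-congʳ (∑₁-distribˡ (suc M) zt _) ⟩
    ∑₁ (suc M) (λ m → zt *ₛ B (m ∸ 1)) +ₛ zt *ₛ D M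
      ≈⟨ +-congʳ (∑₁-cong (suc M) (λ m → ≈ₛ-sym (rhsTerm-suc m))) ⟩
    ∑₁ (suc M) rhsTerm +ₛ zt *ₛ D M
      ∎
    where
    open IndexedFromOne ℤ⟦z⟧⟦t⟧.seriesRing using (∑₁-cong; ∑₁-distribˡ)
    BS : PS
    BS = B (suc M) *ₛ S (X (suc M)) M

  limits-agree : ∀ a b → partialSum1 (suc a) (lhsTerm g) a b ≡.≡ partialSum1 (suc a) rhsTerm a b
  limits-agree a b = ≡.trans (partialSum1-coeff (suc a) (lhsTerm g) a b)
    (≡.trans (ℤ⟦z⟧.at (ℤ⟦z⟧⟦t⟧.coeff-agree {g = ∑₁ (suc a) rhsTerm} {h = zt *ₛ D a} a
                         (partial-sums-differ a) (zt·D-order a)) b)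
             (≡.sym (partialSum1-coeff (suc a) rhsTerm a b)))
    where
    zt·D-order : ∀ M → HasOrder (suc M) (zt *ₛ D M)
    zt·D-order M = HasOrder-mono (ℕP.n≤1+n (suc M)) (HasOrder-* {1} {suc M} zt-order (D-order M))

mainTheorem6 : (g : PS) → g ⊛ (onePS ⊖ zt) ≈ onePS →
    ∃ λ SL → ∃ λ SR → HasSum1 (lhsTerm g) SL × HasSum1 rhsTerm SR × (onePS ⊕ SL ≈ onePS ⊕ SR)
mainTheorem6 g g-inverse =
  (λ a → partialSum1 (suc a) (lhsTerm g) a) , (λ a → partialSum1 (suc a) rhsTerm a) ,
  converges (lhsTerm g) lhs-order , converges rhsTerm rhs-order ,
  λ a b → ≡.cong (onePS a b +ℤ_) (limits-agree a b)
  where open Identity g g-inverse
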